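{- Let $s,t$ be terms and $\sigma$ a normalised substitution with $\mathrm{Var}(s)\subseteq\mathrm{dom}(\sigma)$, and suppose $s,\sigma\to^{m}t,\sigma'$. Then $\sigma'$ extends $\sigma$ and $s\sigma=s\sigma'$.
   Context: Typed rewriting. $\mathcal{C}$ (constructors) and $\mathcal{D}$ (defined symbols) are disjoint finite sets of function symbols with base type declarations; terms respect declarations; values are ground constructor terms. Substitutions respect types; normalised means the range consists of values; $\sigma'$ extends $\sigma$ if $\sigma'$ restricted to $\mathrm{dom}(\sigma)$ equals $\sigma$; $\sigma\uplus\tau$ is the union of substitutions with disjoint domains. $\mathcal{R}$ is a finite set of typed rules $f(l_1,\dots,l_n)\to r$ with $f\in\mathcal{D}$, $l_i$ built from constructors and variables, $\mathrm{Var}(r)\subseteq\mathrm{Var}(l)$; $\mathcal{R}$ is left-linear, non-overlapping and completely defined. Small-step semantics (all substitutions normalised). Judgements $t,\sigma\to^{m}u,\sigma'$ with $m\in\{0,1\}$ are defined by: (i) if $x\sigma=v$ then $x,\sigma\to^{0}v,\sigma$; (ii) if $c\in\mathcal{C}$ and $x_i\sigma=v_i$ for all $i$ then $c(x_1,\dots,x_n),\sigma\to^{0}c(v_1,\dots,v_n),\sigma$; (iii) if $f\in\mathcal{D}$, all $v_i$ are values, $x_1,\dots,x_n$ are fresh and $\rho=\{x_1\mapsto v_1,\dots,x_n\mapsto v_n\}$, then $f(v_1,\dots,v_n),\sigma\to^{0}f(x_1,\dots,x_n),\sigma\uplus\rho$; (iv) if $f(l_1,\dots,l_n)\to r\in\mathcal{R}$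 and $x_i\sigma=l_i\tau$ for all $i$, then $f(x_1,\dots,x_n),\sigma\to^{1}r,\sigma\uplus\tau$; (v) if $t_i,\sigma\to^{1}u,\sigma'$ then $f(\dots,t_i,\dots),\sigma\to^{1}f(\dots,u,\dots),\sigma'$. -}

module Defs where

open import Data.Nat using (ℕ)
open import Data.Fin using (Fin)
open import Data.List using (List; []; _∷_; _++_; length; lookup)
open import Data.List.Membership.Propositional using (_∈_)
open import Data.List.Relation.Unary.Unique.Propositional using (Unique)
open import Data.Maybe using (Maybe; just; nothing; fromMaybe; _<∣>_)
open import Data.Product using (Σ; _×_; _,_; ∃; ∃-syntax)
open import Relation.Binary.PropositionalEquality using (_≡_)
open import Relation.Nullary using (¬_)

-- A typed signature: base types (sorts), finitely many constructors
-- (Fin nC) and finitely many defined symbols (Fin nD), disjoint by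
-- construction, each with a type declaration  ι₁ × … × ιₙ ⇒ ι.
record Signature : Set₁ where
  field
    Sort  : Set
    nC nD : ℕ
    cArgs : Fin nC → List Sort
    cRes  : Fin nC → Sort
    dArgs : Fin nD → List Sort
    dRes  : Fin nD → Sort

module Typed (S : Signature) where
  open Signature S public

  Var : Set
  Var = Σ Sort (λ _ → ℕ)

  mutual
    data Term : Sort → Set where
      var : ∀ {ι} → ℕ → Term ι
      con : (c : Fin nC) → Args (cArgs c) → Term (cRes c)
      fun : (f : Fin nD) → Args (dArgs f) → Term (dRes f)

    data Args : List Sort → Set where
      []  : Args []
      _∷_ : ∀ {ι ιs} → Term ι → Args ιs → Args (ι ∷ ιs)

  mutual
    data Value : ∀ {ι} → Term ι → Set where
      con : ∀ c {as} → Values as → Value (con c as)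

    data Values : ∀ {ιs} → Args ιs → Set where
      []  : Values []
      _∷_ : ∀ {ι ιs} {t : Term ι} {ts : Args ιs} →
            Value t → Values ts → Values (t ∷ ts)

  mutual
    data Pattern : ∀ {ι} → Term ι → Set where
      var : ∀ {ι} n → Pattern (var {ι} n)
      con : ∀ c {as} → Patterns as → Pattern (con c as)

    data Patterns : ∀ {ιs} → Args ιs → Set where
      []  : Patterns []
      _∷_ : ∀ {ι ιs} {t : Term ι} {ts : Args ιs} →
            Pattern t → Patterns ts → Patterns (t ∷ ts)

  mutual
    vars : ∀ {ι} → Term ι → List Var
    vars {ι} (var n) = (ι , n) ∷ []
    vars (con c as) = varsA as
    vars (fun f as) = varsA as

    varsA : ∀ {ιs} → Args ιs → List Var
    varsA []       = []
    varsA (t ∷ ts) = vars t ++ varsA ts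

  Subst : Set
  Subst = (ι : Sort) → ℕ → Maybe (Term ι)

  _∈dom_ : Var → Subst → Set
  (ι , n) ∈dom σ = ∃[ t ] (σ ι n ≡ just t)

  Normalised : Subst → Set
  Normalised σ = ∀ ι n t → σ ι n ≡ just t → Value t

  Extends : Subst → Subst → Set
  Extends σ' σ = ∀ ι n t → σ ι n ≡ just t → σ' ι n ≡ just t

  Disjoint : Subst → Subst → Set
  Disjoint σ τ = ∀ v → v ∈dom σ → ¬ (v ∈dom τ)

  -- union of substitutions (used only for disjoint domains, see Step)
  _∪_ : Subst → Subst → Subst
  (σ ∪ τ) ι n = σ ι n <∣> τ ι n

  mutual
    _[_] : ∀ {ι} → Term ι → Subst → Term ι
    _[_] {ι} (var n) σ = fromMaybe (var n) (σ ι n)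
    con c as [ σ ] = con c (as [ σ ]A)
    fun f as [ σ ] = fun f (as [ σ ]A)

    _[_]A : ∀ {ιs} → Args ιs → Subst → Args ιs
    [] [ σ ]A       = []
    (t ∷ ts) [ σ ]A = (t [ σ ]) ∷ (ts [ σ ]A)

  record Rule : Set where
    field
      fn          : Fin nD
      lhs         : Args (dArgs fn)
      rhs         : Term (dRes fn)
      lhs-pattern : Patterns lhs
      rhs-vars    : ∀ v → v ∈ vars rhs → v ∈ varsA lhs
  open Rule public

  lhsTerm : Rule → Σ Sort Term
  lhsTerm ρ = dRes (fn ρ) , fun (fn ρ) (lhs ρ)

  instTerm : Rule → Subst → Σ Sort Term
  instTerm ρ τ = dRes (fn ρ) , fun (fn ρ) (lhs ρ [ τ ]A)

  LeftLinear : List Rule → Set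
  LeftLinear R = ∀ ρ → ρ ∈ R → Unique (varsA (lhs ρ))

  -- no two distinct rules have unifiable left-hand sides (after renaming apart)
  NonOverlapping : List Rule → Set
  NonOverlapping R = ∀ (i j : Fin (length R)) (τ₁ τ₂ : Subst) →
    instTerm (lookup R i) τ₁ ≡ instTerm (lookup R j) τ₂ → i ≡ j

  CompletelyDefined : List Rule → Set
  CompletelyDefined R = ∀ (f : Fin nD) (vs : Args (dArgs f)) → Values vs →
    ∃[ ρ ] ∃[ τ ] (ρ ∈ R × instTerm ρ τ ≡ (dRes f , fun f vs))

  data VarsTo (σ : Subst) : ∀ {ιs} → Args ιs → Args ιs → Set where
    []  : VarsTo σ [] []
    _∷_ : ∀ {ι ιs n u} {xs us : Args ιs} →
          σ ι n ≡ just u → VarsTo σ xs us → VarsTo σ (var {ι} n ∷ xs) (u ∷ us)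

  -- Small-step semantics  t , σ →^m u , σ'   (written Step R t σ m u σ')
  mutual
    data Step (R : List Rule) : ∀ {ι} → Term ι → Subst → ℕ → Term ι → Subst → Set where
      s-var : ∀ {ι n v σ} → Normalised σ → σ ι n ≡ just v →
              Step R (var {ι} n) σ 0 v σ
      s-con : ∀ {c xs vs σ} → Normalised σ → VarsTo σ xs vs →
              Step R (con c xs) σ 0 (con c vs) σ
      s-fun : ∀ {f vs xs σ ρ} → Normalised σ → Values vs →
              VarsTo ρ xs vs →
              (∀ v → v ∈dom ρ → v ∈ varsA xs) →
              Unique (varsA xs) →
              (∀ v → v ∈ varsA xs → ¬ (v ∈dom σ)) →
              Step R (fun f vs) σ 0 (fun f xs) (σ ∪ ρ)
      s-rule : ∀ {ρ xs σ τ} → ρ ∈ R → Normalised σ → Normalised τ →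
               Disjoint σ τ →
               VarsTo σ xs (lhs ρ [ τ ]A) →
               Step R (fun (fn ρ) xs) σ 1 (rhs ρ) (σ ∪ τ)
      s-ctx-con : ∀ {c as bs σ σ'} → StepArgs R as σ bs σ' →
                  Step R (con c as) σ 1 (con c bs) σ'
      s-ctx-fun : ∀ {f as bs σ σ'} → StepArgs R as σ bs σ' →
                  Step R (fun f as) σ 1 (fun f bs) σ'

    data StepArgs (R : List Rule) : ∀ {ιs} → Args ιs → Subst → Args ιs → Subst → Set where
      here  : ∀ {ι ιs} {t u : Term ι} {ts : Args ιs} {σ σ'} →
              Step R t σ 1 u σ' → StepArgs R (t ∷ ts) σ (u ∷ ts) σ'
      there : ∀ {ι ιs} {t : Term ι} {ts us : Args ιs} {σ σ'} →
              StepArgs R ts σ us σ' → StepArgs R (t ∷ ts) σ (t ∷ us) σ'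

-- A step only ever adds bindings (rules (iii) and (iv) extend σ by a union
-- in which σ takes precedence, all other rules keep σ), and applying a
-- substitution to a term only consults the variables of that term; on those
-- variables σ and any extension of σ agree.
module Submission where

open import Defs
open import Data.Nat using (ℕ)
open import Data.List using (List; _∷_)
open import Data.List.Membership.Propositional using (_∈_)
open import Data.List.Membership.Propositional.Properties using (∈-++⁺ˡ; ∈-++⁺ʳ)
open import Data.List.Relation.Unary.Any using (here)
open import Data.Product using (_×_; _,_)
open import Relation.Binary.PropositionalEquality using (_≡_; refl; cong; cong₂)

module _ (S : Signature) where
  open Typed S

  Extends-refl : ∀ σ → Extends σ σ
  Extends-refl σ ι n t σn≡t = σn≡t

  Extends-∪ : ∀ σ τ → Extends (σ ∪ τ) σ
  Extends-∪ σ τ ι n t σn≡t rewrite σn≡t = refl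

  mutual
    Step⇒Extends : ∀ {R ι m} {s t : Term ι} {σ σ'} →
                   Step R s σ m t σ' → Extends σ' σ
    Step⇒Extends {σ = σ} (s-var _ _)                 = Extends-refl σ
    Step⇒Extends {σ = σ} (s-con _ _)                 = Extends-refl σ
    Step⇒Extends {σ = σ} (s-fun {ρ = ρ} _ _ _ _ _ _) = Extends-∪ σ ρ
    Step⇒Extends {σ = σ} (s-rule {τ = τ} _ _ _ _ _)  = Extends-∪ σ τ
    Step⇒Extends (s-ctx-con steps)                   = StepArgs⇒Extends steps
    Step⇒Extends (s-ctx-fun steps)                   = StepArgs⇒Extends steps

    StepArgs⇒Extends : ∀ {R ιs} {ss ts : Args ιs} {σ σ'} →
                       StepArgs R ss σ ts σ' → Extends σ' σ
    StepArgs⇒Extends (here step)   = Step⇒Extends step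
    StepArgs⇒Extends (there steps) = StepArgs⇒Extends steps

  mutual
    subst-extends : ∀ {ι} (s : Term ι) {σ σ'} → Extends σ' σ →
                    (∀ v → v ∈ vars s → v ∈dom σ) → s [ σ ] ≡ s [ σ' ]
    subst-extends {ι} (var n) σ'⊇σ covered with covered (ι , n) (here refl)
    ... | u , σn≡u rewrite σn≡u | σ'⊇σ ι n u σn≡u = refl
    subst-extends (con c as) σ'⊇σ covered = cong (con c) (substA-extends as σ'⊇σ covered)
    subst-extends (fun f as) σ'⊇σ covered = cong (fun f) (substA-extends as σ'⊇σ covered)

    substA-extends : ∀ {ιs} (ss : Args ιs) {σ σ'} → Extends σ' σ →
                     (∀ v → v ∈ varsA ss → v ∈dom σ) → ss [ σ ]A ≡ ss [ σ' ]A
    substA-extends []       σ'⊇σ covered = refl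
    substA-extends (s ∷ ss) σ'⊇σ covered = cong₂ _∷_
      (subst-extends s σ'⊇σ (λ v v∈s → covered v (∈-++⁺ˡ v∈s)))
      (substA-extends ss σ'⊇σ (λ v v∈ss → covered v (∈-++⁺ʳ (vars s) v∈ss)))

lemma3 : (S : Signature) → let open Typed S in
    (R : List Rule) → LeftLinear R → NonOverlapping R → CompletelyDefined R →
    ∀ {ι} (s t : Term ι) (σ σ' : Subst) (m : ℕ) →
    Normalised σ →
    (∀ v → v ∈ vars s → v ∈dom σ) →
    Step R s σ m t σ' →
    Extends σ' σ × (s [ σ ] ≡ s [ σ' ])
lemma3 S _ _ _ _ s _ _ _ _ _ covered step =
  σ'⊇σ , subst-extends S s σ'⊇σ covered
  where σ'⊇σ = Step⇒Extends S step
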